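{- Let $f(n)$ denote the minimum of $\operatorname{th_{dim}}(G)$ over all graphs $G$ of order $n$. Then $f(n)=\Theta\left(\frac{\log n}{\log\log n}\right)$, i.e., there are constants $c_1,c_2>0$ and $n_0$ such that $c_1\frac{\log n}{\log\log n}\le f(n)\le c_2\frac{\log n}{\log\log n}$ for all $n\ge n_0$.
   Context: All graphs are finite and simple. $\operatorname{dist}(u,v)$ is the shortest-path distance ($\infty$ across components). For a nonnegative integer $r$, $\operatorname{dist}_r(x,v)=\min(\operatorname{dist}(x,v),r+1)$. A set $S\subseteq V(G)$ is a distance-$r$ resolving set if for all distinct $x,y\in V(G)$ there is $v\in S$ with $\operatorname{dist}_r(v,x)\ne\operatorname{dist}_r(v,y)$. $\dim_r(G)$ is the minimum size of such a set and $\operatorname{th_{dim}}(G)=\min_{r\ge0}(r+\dim_r(G))$ over nonnegative integers $r$. -}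

module Defs where

open import Data.Nat using (ℕ; zero; suc; _+_; _*_; _≤_; _<_)
open import Data.Bool using (Bool; true; false; _∧_; _∨_; if_then_else_)
open import Data.Fin using (Fin; _≟_)
open import Data.Fin.Subset using (Subset; _∈_; ∣_∣)
open import Data.List using (List; allFin)
open import Data.Bool.ListAction using (any)
open import Data.Product using (Σ; _×_; ∃; ∃-syntax)
open import Relation.Nullary using (¬_)
open import Relation.Nullary.Decidable using (isYes)
open import Relation.Binary.PropositionalEquality using (_≡_; _≢_)

record Graph (n : ℕ) : Set where
  field
    adj    : Fin n → Fin n → Bool
    sym    : ∀ x y → adj x y ≡ adj y x
    irrefl : ∀ x → adj x x ≡ false
open Graph public

reach : ∀ {n} → Graph n → ℕ → Fin n → Fin n → Bool
reach G zero    x y = isYes (x ≟ y)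
reach {n} G (suc k) x y = reach G k x y ∨ any (λ z → reach G k x z ∧ adj G z y) (allFin n)

-- dist_r(x,y) = min(dist(x,y), r+1)
distR : ∀ {n} → Graph n → ℕ → Fin n → Fin n → ℕ
distR G zero    x y = if reach G zero x y then 0 else 1
distR G (suc r) x y =
  if reach G r x y then distR G r x y
  else (if reach G (suc r) x y then suc r else suc (suc r))

Resolving : ∀ {n} → Graph n → ℕ → Subset n → Set
Resolving {n} G r S =
  ∀ (x y : Fin n) → x ≢ y → ∃[ v ] (v ∈ S × distR G r v x ≢ distR G r v y)

ThdimLE : ∀ {n} → Graph n → ℕ → Set
ThdimLE {n} G t = ∃[ r ] ∃[ S ] (Resolving G r S × r + ∣ S ∣ ≤ t)

IsThdim : ∀ {n} → Graph n → ℕ → Set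
IsThdim G t = ThdimLE G t × (∀ t' → ThdimLE G t' → t ≤ t')

IsF : ℕ → ℕ → Set
IsF n k = (Σ (Graph n) λ G → IsThdim G k) × (∀ (G : Graph n) t → IsThdim G t → k ≤ t)

-- Lower bound.  A distance-r resolving set S maps the n vertices injectively into
-- {0, …, r+1}^|S|, so n ≤ (r+2)^|S| ≤ (k+2)^k where k = th_dim(G) ≥ r + |S|; hence
-- log n ≤ k log (k+2).
--
-- Put r = 2s and R = r + 1, and take as vertices vectors b ∈ {0, …, R}^s whose
-- coordinates pairwise sum to at least R, two vectors being adjacent when they differ by at most
-- one in every coordinate.  The only such vector with b_k = 0 is the landmark (R, …, 0, …, R).
-- If the family is closed under the move "lower b_k ≤ r by one and raise every other coordinate
-- below R by one", then the distance from the k-th landmark truncated at r + 1 is exactly b_k,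
-- so the s landmarks resolve the graph and th_dim ≤ r + s = 3s.  Closed families of every size
-- between (1 + sR)^2 and (s+1)^s exist: keep the vectors with at most two coordinates below R
-- together with those whose rank, an injective encoding ordered first by the coordinate sum,
-- is at least θ.  The move raises the sum as soon as three coordinates lie below R, and
-- increasing θ by one deletes at most one vector.  With s least such that n ≤ (s+1)^s this
-- gives f(n) ≤ 3s while s^(s-1) < n, and both bounds turn into Θ(log n / log log n).
--
-- The minimum defining f(n) exists constructively because th_dim(G) ≤ t is decidable and
-- graphs of order n can be enumerated.

module Submission where

open import Defs
open import Data.Nat using (ℕ; _+_; _*_; _≤_; _<_)
open import Data.Nat.Logarithm using (⌊log₂_⌋)
open import Data.Product using (Σ; _×_; ∃-syntax)

open import Data.Bool using (Bool; true; false; T; not; _∧_; _∨_; if_then_else_)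
open import Data.Bool.ListAction using (or)
open import Data.Bool.Properties using (T-∨; T-∧; ∨-comm; ∨-idem)
open import Data.Empty using (⊥-elim)
open import Data.Fin using (Fin; zero; suc; _≟_; fromℕ<; combine; remQuot)
open import Data.Fin.Properties using (¬∀⟶∃¬; injective⇒≤; fromℕ<-injective; remQuot-combine; all?; any?)
open import Data.Fin.Subset using (Subset; ∣_∣; ⁅_⁆; _∪_; ⊥) renaming (_∈_ to _∈ₛ_)
open import Data.Fin.Subset.Properties using (anySubset?; _∈?_; x∈⁅x⁆; ∣⁅x⁆∣≡1; x∈p∪q⁺; ∣⊥∣≡0)
open import Data.List using (List; []; _∷_; allFin; length; filter; cartesianProductWith; downFrom)
import Data.List as List
open import Data.List.Membership.Propositional using (_∈_; lose)
open import Data.List.Membership.Propositional.Properties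
  using ( ∈-allFin; ∈-lookup; ∈-filter⁺; ∈-filter⁻; ∈-downFrom⁺; ∈-downFrom⁻
        ; ∈-cartesianProductWith⁺; ∈-cartesianProductWith⁻)
open import Data.List.Properties using (map-cong; filter-none; filter-++; length-++)
import Data.List.Relation.Unary.All as ListAll
open import Data.List.Relation.Unary.AllPairs using ([]; _∷_)
open import Data.List.Relation.Unary.Any using (here; there; satisfied; index)
open import Data.List.Relation.Unary.Any.Properties using (any⁺; any⁻; lookup-index)
open import Data.List.Relation.Unary.Unique.Propositional using (Unique)
import Data.List.Relation.Unary.Unique.Propositional.Properties as Unique
open import Data.Nat
  using (zero; suc; pred; _∸_; _^_; _%_; _<?_; ⌊_/2⌋; ⌈_/2⌉; z≤n; s≤s; _≤′_; ≤′-refl; ≤′-step; NonZero; >-nonZero)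
open import Data.Nat.DivMod using (m<n⇒m%n≡m; [m+kn]%n≡m%n)
open import Data.Nat.Induction using (<-rec)
open import Data.Nat.ListAction using () renaming (sum to sumˡ)
open import Data.Nat.Logarithm using (⌊log₂⌋-mono-≤; ⌊log₂⌊n/2⌋⌋≡⌊log₂n⌋∸1; ⌊log₂[2^n]⌋≡n)
open import Data.Nat.Properties hiding (_≟_)
import Data.Nat.Properties as ℕ
open import Algebra.Properties.CommutativeSemigroup +-commutativeSemigroup using (interchange)
open import Data.Nat.Solver using (module +-*-Solver)
open import Data.Product using (_,_; proj₁; proj₂; map₂; uncurry; swap)
open import Data.Sum using (_⊎_; inj₁; inj₂)
open import Data.Vec using (Vec; []; _∷_; lookup; tabulate; map; sum; replicate)
import Data.Vec as Vec
open import Data.Vec.Properties using (∷-injectiveˡ; ∷-injectiveʳ; lookup∘tabulate; tabulate∘lookup; tabulate-cong)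
open import Data.Vec.Relation.Binary.Pointwise.Inductive using (Pointwise; []; _∷_)
import Data.Vec.Relation.Binary.Pointwise.Inductive as Pointwise
open import Data.Vec.Relation.Unary.All using (All; []; _∷_)
import Data.Vec.Relation.Unary.All as All
open import Data.Vec.Relation.Unary.All.Properties using (map⁺; lookup⁺)
open import Data.Vec.Relation.Unary.AllPairs using (AllPairs; []; _∷_; allPairs?)
open import Function using (_∘_; id; _⇔_; mk⇔; Equivalence)
open import Relation.Binary.PropositionalEquality using (_≡_; _≢_; refl; cong; cong₂; trans; subst; module ≡-Reasoning)
import Relation.Binary.PropositionalEquality as ≡
open import Relation.Nullary using (¬_; Dec; yes; no; map′)
open import Relation.Nullary.Decidable
  using (isYes; isYes≗does; does-⇔; dec-false; decidable-stable; toWitness; fromWitness; ¬?; _×-dec_; _⊎-dec_; _→-dec_)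
open import Relation.Unary using (Decidable)

open Equivalence using (to; from)

if-elim : ∀ {a p} {A : Set a} (P : A → Set p) b {t e : A} →
          (T b → P t) → (¬ T b → P e) → P (if b then t else e)
if-elim P true  on-true on-false = on-true _
if-elim P false on-true on-false = on-false id

isYes-⇔ : ∀ {a b} {A : Set a} {B : Set b} → A ⇔ B → (a? : Dec A) (b? : Dec B) → isYes a? ≡ isYes b?
isYes-⇔ A⇔B a? b? = trans (isYes≗does a?) (trans (does-⇔ A⇔B a? b?) (≡.sym (isYes≗does b?)))

isYes-false : ∀ {a} {A : Set a} → ¬ A → (a? : Dec A) → isYes a? ≡ false
isYes-false ¬a a? = trans (isYes≗does a?) (dec-false a? ¬a)

IsLeast : ∀ {p} → (ℕ → Set p) → ℕ → Set p
IsLeast P k = P k × (∀ {t} → P t → k ≤ t)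

least : ∀ {p} {P : ℕ → Set p} → Decidable P → ∀ {t} → P t → ∃[ k ] IsLeast P k
least {P = P} P? {t} = <-rec (λ t → P t → ∃[ k ] IsLeast P k) search t
  where
  search : ∀ t → (∀ {u} → u < t → P u → ∃[ k ] IsLeast P k) → P t → ∃[ k ] IsLeast P k
  search t smaller Pt with anyUpTo? P? t
  ... | yes (u , u<t , Pu) = smaller u<t Pu
  ... | no ∄u<t            = t , Pt , λ {t′} Pt′ → ≮⇒≥ λ t′<t → ∄u<t (t′ , t′<t , Pt′)

n≤1+pred[n] : ∀ n → n ≤ suc (pred n)
n≤1+pred[n] zero    = z≤n
n≤1+pred[n] (suc n) = ≤-refl

discrete-ivt : ∀ (f : ℕ → ℕ) → (∀ θ → f θ ≤ suc (f (suc θ))) →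
               ∀ K {n} → f K ≤ n → n ≤ f 0 → ∃[ θ ] f θ ≡ n
discrete-ivt f _    zero    fK≤n n≤f0 = 0 , ≤-antisym fK≤n n≤f0
discrete-ivt f step (suc K) {n} f1+K≤n n≤f0 with f K ≤? n
... | yes fK≤n = discrete-ivt f step K fK≤n n≤f0
... | no  fK≰n = suc K , ≤-antisym f1+K≤n (≤-pred (≤-trans (≰⇒> fK≰n) (step K)))

≗-lookup⇒≡ : ∀ {a} {A : Set a} {s} {xs ys : Vec A s} → (∀ i → lookup xs i ≡ lookup ys i) → xs ≡ ys
≗-lookup⇒≡ {xs = xs} {ys} same = trans (≡.sym (tabulate∘lookup xs)) (trans (tabulate-cong same) (tabulate∘lookup ys))

lookup-injective : ∀ {a} {A : Set a} {xs : List A} → Unique xs →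
                   ∀ {i j} → List.lookup xs i ≡ List.lookup xs j → i ≡ j
lookup-injective {xs = _ ∷ _} (x∉ ∷ u) {zero}  {zero}  _  = refl
lookup-injective {xs = _ ∷ _} (x∉ ∷ u) {zero}  {suc j} eq = ⊥-elim (ListAll.lookup x∉ (∈-lookup j) eq)
lookup-injective {xs = _ ∷ _} (x∉ ∷ u) {suc i} {zero}  eq = ⊥-elim (ListAll.lookup x∉ (∈-lookup i) (≡.sym eq))
lookup-injective {xs = _ ∷ _} (x∉ ∷ u) {suc i} {suc j} eq = cong suc (lookup-injective u eq)

∣p∪q∣≤∣p∣+∣q∣ : ∀ {n} (p q : Subset n) → ∣ p ∪ q ∣ ≤ ∣ p ∣ + ∣ q ∣
∣p∪q∣≤∣p∣+∣q∣ []          []          = z≤n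
∣p∪q∣≤∣p∣+∣q∣ (true ∷ p)  (true ∷ q)  =
  s≤s (≤-trans (m≤n⇒m≤1+n (∣p∪q∣≤∣p∣+∣q∣ p q)) (≤-reflexive (≡.sym (+-suc _ _))))
∣p∪q∣≤∣p∣+∣q∣ (true ∷ p)  (false ∷ q) = s≤s (∣p∪q∣≤∣p∣+∣q∣ p q)
∣p∪q∣≤∣p∣+∣q∣ (false ∷ p) (true ∷ q)  =
  ≤-trans (s≤s (∣p∪q∣≤∣p∣+∣q∣ p q)) (≤-reflexive (≡.sym (+-suc _ _)))
∣p∪q∣≤∣p∣+∣q∣ (false ∷ p) (false ∷ q) = ∣p∪q∣≤∣p∣+∣q∣ p q

image : ∀ {m n} → (Fin m → Fin n) → Subset n
image {zero}  f = ⊥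
image {suc m} f = ⁅ f zero ⁆ ∪ image (f ∘ suc)

∣image∣≤ : ∀ {m n} (f : Fin m → Fin n) → ∣ image f ∣ ≤ m
∣image∣≤ {zero}  {n} f = ≤-reflexive (∣⊥∣≡0 n)
∣image∣≤ {suc m}     f = begin
  ∣ ⁅ f zero ⁆ ∪ image (f ∘ suc) ∣        ≤⟨ ∣p∪q∣≤∣p∣+∣q∣ ⁅ f zero ⁆ (image (f ∘ suc)) ⟩
  ∣ ⁅ f zero ⁆ ∣ + ∣ image (f ∘ suc) ∣    ≡⟨ cong (_+ ∣ image (f ∘ suc) ∣) (∣⁅x⁆∣≡1 (f zero)) ⟩
  suc ∣ image (f ∘ suc) ∣                 ≤⟨ s≤s (∣image∣≤ (f ∘ suc)) ⟩
  suc m                                   ∎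
  where open ≤-Reasoning

∈-image : ∀ {m n} (f : Fin m → Fin n) i → f i ∈ₛ image f
∈-image f zero    = x∈p∪q⁺ (inj₁ (x∈⁅x⁆ (f zero)))
∈-image f (suc i) = x∈p∪q⁺ (inj₂ (∈-image (f ∘ suc) i))

module _ {a} {A : Set a} where

  count : ∀ {p} {P : A → Set p} → Decidable P → List A → ℕ
  count P? xs = length (filter P? xs)

  count-mono : ∀ {p q} {P : A → Set p} {Q : A → Set q} (P? : Decidable P) (Q? : Decidable Q) xs →
               (∀ {x} → x ∈ xs → P x → Q x) → count P? xs ≤ count Q? xs
  count-mono P? Q? []       P⇒Q = z≤n
  count-mono P? Q? (x ∷ xs) P⇒Q with P? x | Q? x
  ... | yes _  | yes _  = s≤s (count-mono P? Q? xs (P⇒Q ∘ there))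
  ... | yes px | no ¬qx = ⊥-elim (¬qx (P⇒Q (here refl) px))
  ... | no _   | yes _  = m≤n⇒m≤1+n (count-mono P? Q? xs (P⇒Q ∘ there))
  ... | no _   | no _   = count-mono P? Q? xs (P⇒Q ∘ there)

  count-⊎ : ∀ {p q} {P : A → Set p} {Q : A → Set q} (P? : Decidable P) (Q? : Decidable Q) xs →
            count (λ x → P? x ⊎-dec Q? x) xs ≤ count P? xs + count Q? xs
  count-⊎ P? Q? []       = z≤n
  count-⊎ P? Q? (x ∷ xs) with P? x | Q? x
  ... | yes _ | yes _ = s≤s (≤-trans (count-⊎ P? Q? xs) (+-monoʳ-≤ (count P? xs) (n≤1+n _)))
  ... | yes _ | no _  = s≤s (count-⊎ P? Q? xs)
  ... | no _  | yes _ = ≤-trans (s≤s (count-⊎ P? Q? xs)) (≤-reflexive (≡.sym (+-suc _ _)))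
  ... | no _  | no _  = count-⊎ P? Q? xs

  count-≤1 : ∀ {p} {P : A → Set p} (P? : Decidable P) {xs} → Unique xs →
             (∀ {x y} → x ∈ xs → y ∈ xs → P x → P y → x ≡ y) → count P? xs ≤ 1
  count-≤1 P? {[]}     _        _          = z≤n
  count-≤1 P? {x ∷ xs} (x∉ ∷ u) at-most-one with P? x
  ... | yes px = ≤-reflexive (cong (suc ∘ length) (filter-none P? (ListAll.tabulate λ y∈ py →
                   ListAll.lookup x∉ y∈ (at-most-one (here refl) (there y∈) px py))))
  ... | no _   = count-≤1 P? u (λ x∈ y∈ → at-most-one (there x∈) (there y∈))

  count-++ : ∀ {p} {P : A → Set p} (P? : Decidable P) xs ys → count P? (xs List.++ ys) ≡ count P? xs + count P? ys
  count-++ P? xs ys = trans (cong length (filter-++ P? xs ys)) (length-++ (filter P? xs))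

module _ {a b c} {A : Set a} {B : Set b} {C : Set c} where

  count-map : ∀ {p} {P : C → Set p} (P? : Decidable P) (f : B → C) ys → count P? (List.map f ys) ≡ count (P? ∘ f) ys
  count-map P? f []       = refl
  count-map P? f (y ∷ ys) with P? (f y)
  ... | yes _ = cong suc (count-map P? f ys)
  ... | no _  = count-map P? f ys

  count-cartesianProductWith : ∀ {p} {P : C → Set p} (P? : Decidable P) (f : A → B → C) xs ys →
    count P? (cartesianProductWith f xs ys) ≡ sumˡ (List.map (λ x → count (P? ∘ f x) ys) xs)
  count-cartesianProductWith P? f []       ys = refl
  count-cartesianProductWith P? f (x ∷ xs) ys =
    trans (count-++ P? (List.map (f x) ys) _) (cong₂ _+_ (count-map P? (f x) ys) (count-cartesianProductWith P? f xs ys))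

sum-downFrom-≤ : ∀ (g : ℕ → ℕ) {c} m → (∀ {x} → x < m → g x ≤ c) → sumˡ (List.map g (downFrom m)) ≤ m * c
sum-downFrom-≤ g zero    _     = z≤n
sum-downFrom-≤ g (suc m) g≤c = +-mono-≤ (g≤c ≤-refl) (sum-downFrom-≤ g m (g≤c ∘ m<n⇒m<1+n))

sum-downFrom-≥ : ∀ (g : ℕ → ℕ) {a c} m → (∀ {x} → a ≤ x → x < m → c ≤ g x) →
                 (m ∸ a) * c ≤ sumˡ (List.map g (downFrom m))
sum-downFrom-≥ g {a} {c} zero c≤g = ≤-reflexive (cong (_* c) (0∸n≡0 a))
sum-downFrom-≥ g {a} {c} (suc m) c≤g with a ≤? m
... | yes a≤m = begin
  (suc m ∸ a) * c                  ≡⟨ cong (_* c) (+-∸-assoc 1 a≤m) ⟩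
  c + (m ∸ a) * c                  ≤⟨ +-mono-≤ (c≤g a≤m ≤-refl)
                                        (sum-downFrom-≥ g m (λ a≤x x<m → c≤g a≤x (m<n⇒m<1+n x<m))) ⟩
  g m + sumˡ (List.map g (downFrom m)) ∎
  where open ≤-Reasoning
... | no a≰m = ≤-trans (≤-reflexive (cong (_* c) (m≤n⇒m∸n≡0 (≰⇒> a≰m)))) z≤n

encode : ℕ → ∀ {s} → Vec ℕ s → ℕ
encode B []       = 0
encode B (x ∷ xs) = x + encode B xs * B

digits-unique : ∀ {B a a′} c c′ → a < B → a′ < B → a + c * B ≡ a′ + c′ * B → a ≡ a′ × c ≡ c′
digits-unique {B} {a} {a′} c c′ a<B a′<B eq = a≡a′ , *-cancelʳ-≡ c c′ B c*B≡c′*B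
  where
  instance
    B≢0 : NonZero B
    B≢0 = >-nonZero (≤-<-trans z≤n a<B)
  open ≡-Reasoning
  a≡a′ : a ≡ a′
  a≡a′ = begin
    a                  ≡⟨ m<n⇒m%n≡m a<B ⟨
    a % B              ≡⟨ [m+kn]%n≡m%n a c B ⟨
    (a + c * B) % B    ≡⟨ cong (_% B) eq ⟩
    (a′ + c′ * B) % B  ≡⟨ [m+kn]%n≡m%n a′ c′ B ⟩
    a′ % B             ≡⟨ m<n⇒m%n≡m a′<B ⟩
    a′                 ∎
  c*B≡c′*B : c * B ≡ c′ * B
  c*B≡c′*B = +-cancelˡ-≡ a _ _ (trans eq (cong (_+ c′ * B) (≡.sym a≡a′)))

encode-< : ∀ {B s} {xs : Vec ℕ s} → All (_< B) xs → encode B xs < B ^ s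
encode-< [] = s≤s z≤n
encode-< {B} {suc s} {x ∷ xs} (x<B ∷ xs<B) = begin-strict
  x + encode B xs * B    <⟨ +-monoˡ-< _ x<B ⟩
  suc (encode B xs) * B  ≤⟨ *-monoˡ-≤ B (encode-< xs<B) ⟩
  B ^ s * B              ≡⟨ *-comm (B ^ s) B ⟩
  B ^ suc s              ∎
  where open ≤-Reasoning

encode-injective : ∀ {B s} {xs ys : Vec ℕ s} → All (_< B) xs → All (_< B) ys →
                   encode B xs ≡ encode B ys → xs ≡ ys
encode-injective [] [] _ = refl
encode-injective (x<B ∷ xs<B) (y<B ∷ ys<B) eq with refl , eq′ ← digits-unique _ _ x<B y<B eq =
  cong (_ ∷_) (encode-injective xs<B ys<B eq′)

-- Truncated distances

module _ {n} (G : Graph n) where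

  reach-zero⁻ : ∀ {x y} → T (reach G 0 x y) → x ≡ y
  reach-zero⁻ = toWitness

  reach-refl : ∀ {x} → T (reach G 0 x x)
  reach-refl = fromWitness refl

  reach-suc⁺ : ∀ {k x y} → T (reach G k x y) → T (reach G (suc k) x y)
  reach-suc⁺ t = from T-∨ (inj₁ t)

  reach-step : ∀ {k x z y} → T (reach G k x z) → T (adj G z y) → T (reach G (suc k) x y)
  reach-step {z = z} t a = from T-∨ (inj₂ (any⁺ _ (lose (∈-allFin z) (from T-∧ (t , a)))))

  reach-suc⁻ : ∀ {k x y} → T (reach G (suc k) x y) →
               T (reach G k x y) ⊎ ∃[ z ] (T (reach G k x z) × T (adj G z y))
  reach-suc⁻ t with to T-∨ t
  ... | inj₁ t′ = inj₁ t′
  ... | inj₂ a  = inj₂ (map₂ (to T-∧) (satisfied (any⁻ _ (allFin n) a)))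

  reach-mono′ : ∀ {j k x y} → j ≤′ k → T (reach G j x y) → T (reach G k x y)
  reach-mono′ ≤′-refl                       t = t
  reach-mono′ {k = suc k} {x} (≤′-step j≤k) t = reach-suc⁺ {k} {x} (reach-mono′ j≤k t)

  reach-mono : ∀ {j k x y} → j ≤ k → T (reach G j x y) → T (reach G k x y)
  reach-mono = reach-mono′ ∘ ≤⇒≤′

  distR-unique : ∀ r {x y d} → d ≤ suc r →
                 (∀ {k} → k ≤ r → T (reach G k x y) ⇔ d ≤ k) → distR G r x y ≡ d
  distR-unique zero {x} {y} {d} d≤1 reach⇔ =
    if-elim (_≡ d) (reach G 0 x y)
      (λ t → ≡.sym (n≤0⇒n≡0 (to (reach⇔ z≤n) t)))
      (λ ¬t → ≤-antisym (≰⇒> (¬t ∘ from (reach⇔ z≤n))) d≤1)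
  distR-unique (suc r) {x} {y} {d} d≤2+r reach⇔ =
    if-elim (_≡ d) (reach G r x y)
      (λ t → distR-unique r (m≤n⇒m≤1+n (to (reach⇔ (n≤1+n r)) t)) (λ k≤r → reach⇔ (m≤n⇒m≤1+n k≤r)))
      (λ ¬t → if-elim (_≡ d) (reach G (suc r) x y)
        (λ t′ → ≤-antisym (≰⇒> (¬t ∘ from (reach⇔ (n≤1+n r)))) (to (reach⇔ ≤-refl) t′))
        (λ ¬t′ → ≤-antisym (≰⇒> (¬t′ ∘ from (reach⇔ ≤-refl))) d≤2+r))

  distR-≤ : ∀ r x y → distR G r x y ≤ suc r
  distR-≤ zero    x y = if-elim (_≤ 1) (reach G 0 x y) (λ _ → z≤n) (λ _ → ≤-refl)
  distR-≤ (suc r) x y = if-elim (_≤ 2 + r) (reach G r x y)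
    (λ _ → m≤n⇒m≤1+n (distR-≤ r x y))
    (λ _ → if-elim (_≤ 2 + r) (reach G (suc r) x y) (λ _ → n≤1+n _) (λ _ → ≤-refl))

record Layering {n} (G : Graph n) (r : ℕ) (v : Fin n) (φ : Fin n → ℕ) : Set where
  field
    root      : φ v ≡ 0
    root-only : ∀ {y} → φ y ≡ 0 → y ≡ v
    lipschitz : ∀ {z y} → T (adj G z y) → φ y ≤ suc (φ z)
    descent   : ∀ {y} → 0 < φ y → φ y ≤ r → ∃[ z ] (T (adj G z y) × suc (φ z) ≡ φ y)

module _ {n} {G : Graph n} {r v φ} (L : Layering G r v φ) where
  open Layering L

  reach⇒φ≤ : ∀ {k y} → T (reach G k v y) → φ y ≤ k
  reach⇒φ≤ {zero} t with refl ← reach-zero⁻ G t = ≤-reflexive root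
  reach⇒φ≤ {suc k} t with reach-suc⁻ G {k} {v} t
  ... | inj₁ t′          = m≤n⇒m≤1+n (reach⇒φ≤ t′)
  ... | inj₂ (z , t′ , a) = ≤-trans (lipschitz a) (s≤s (reach⇒φ≤ t′))

  φ≡⇒reach : ∀ m {y} → φ y ≡ m → m ≤ r → T (reach G m v y)
  φ≡⇒reach zero    φy≡0 _ with refl ← root-only φy≡0 = reach-refl G
  φ≡⇒reach (suc m) {y} φy≡1+m 1+m≤r =
    let z , a , 1+φz≡φy = descent 0<φy φy≤r
    in reach-step G {m} {v} (φ≡⇒reach m (suc-injective (trans 1+φz≡φy φy≡1+m)) (<⇒≤ 1+m≤r)) a
    where
    0<φy : 0 < φ y
    0<φy = subst (0 <_) (≡.sym φy≡1+m) (s≤s z≤n)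
    φy≤r : φ y ≤ r
    φy≤r = subst (_≤ r) (≡.sym φy≡1+m) 1+m≤r

  distR-layering : ∀ {y} → φ y ≤ suc r → distR G r v y ≡ φ y
  distR-layering φy≤1+r = distR-unique G r φy≤1+r λ k≤r →
    mk⇔ reach⇒φ≤ (λ φy≤k → reach-mono G {x = v} φy≤k (φ≡⇒reach _ refl (≤-trans φy≤k k≤r)))

-- Resolving sets bound the order

profile : ∀ {m} (S : Subset m) → (Fin m → ℕ) → Vec ℕ ∣ S ∣
profile []          d = []
profile (true ∷ S)  d = d zero ∷ profile S (d ∘ suc)
profile (false ∷ S) d = profile S (d ∘ suc)

profile-< : ∀ {m B} (S : Subset m) {d} → (∀ v → d v < B) → All (_< B) (profile S d)
profile-< []          d<B = []
profile-< (true ∷ S)  d<B = d<B zero ∷ profile-< S (d<B ∘ suc)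
profile-< (false ∷ S) d<B = profile-< S (d<B ∘ suc)

profile-injective : ∀ {m} (S : Subset m) {d d′} → profile S d ≡ profile S d′ →
                    ∀ {v} → v ∈ₛ S → d v ≡ d′ v
profile-injective (true ∷ S)  eq Vec.here        = ∷-injectiveˡ eq
profile-injective (true ∷ S)  eq (Vec.there v∈S) = profile-injective S (∷-injectiveʳ eq) v∈S
profile-injective (false ∷ S) eq (Vec.there v∈S) = profile-injective S eq v∈S

resolving⇒order≤ : ∀ {n} (G : Graph n) r S → Resolving G r S → n ≤ (2 + r) ^ ∣ S ∣
resolving⇒order≤ {n} G r S resolving = injective⇒≤ code-injective
  where
  distances<2+r : ∀ x v → distR G r v x < 2 + r
  distances<2+r x v = s≤s (distR-≤ G r v x)
  code : Fin n → Fin ((2 + r) ^ ∣ S ∣)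
  code x = fromℕ< (encode-< (profile-< S (distances<2+r x)))
  code-injective : ∀ {x y} → code x ≡ code y → x ≡ y
  code-injective {x} {y} eq = decidable-stable (x ≟ y) λ x≢y →
    let v , v∈S , differ = resolving x y x≢y
    in differ (profile-injective S (encode-injective (profile-< S (distances<2+r x))
                 (profile-< S (distances<2+r y)) (fromℕ<-injective _ _ _ _ eq)) v∈S)

thdim⇒order≤ : ∀ {n} (G : Graph n) {k} → ThdimLE G k → n ≤ (2 + k) ^ k
thdim⇒order≤ {n} G {k} (r , S , resolving , r+∣S∣≤k) = begin
  n                ≤⟨ resolving⇒order≤ G r S resolving ⟩
  (2 + r) ^ ∣ S ∣  ≤⟨ ^-monoˡ-≤ ∣ S ∣ (s≤s (s≤s (m+n≤o⇒m≤o r r+∣S∣≤k))) ⟩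
  (2 + k) ^ ∣ S ∣  ≤⟨ ^-monoʳ-≤ (2 + k) (m+n≤o⇒n≤o r r+∣S∣≤k) ⟩
  (2 + k) ^ k      ∎
  where open ≤-Reasoning

-- Computing f

module _ {n} {G G′ : Graph n} (same-adj : ∀ x y → adj G x y ≡ adj G′ x y) where

  reach-cong : ∀ k x y → reach G k x y ≡ reach G′ k x y
  reach-cong zero    x y = refl
  reach-cong (suc k) x y = cong₂ _∨_ (reach-cong k x y)
    (cong or (map-cong (λ z → cong₂ _∧_ (reach-cong k x z) (same-adj z y)) (allFin n)))

  distR-cong : ∀ r x y → distR G r x y ≡ distR G′ r x y
  distR-cong zero    x y = refl
  distR-cong (suc r) x y = branches (reach-cong r x y) (distR-cong r x y) (reach-cong (suc r) x y)
    where
    branches : ∀ {a a′ d d′ b b′} → a ≡ a′ → d ≡ d′ → b ≡ b′ →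
               (if a then d else if b then suc r else suc (suc r)) ≡
               (if a′ then d′ else if b′ then suc r else suc (suc r))
    branches refl refl refl = refl

  thdim-cong : ∀ {t} → ThdimLE G t → ThdimLE G′ t
  thdim-cong (r , S , resolving , r+∣S∣≤t) = r , S , resolving′ , r+∣S∣≤t
    where
    resolving′ : Resolving G′ r S
    resolving′ x y x≢y =
      let v , v∈S , differ = resolving x y x≢y
      in v , v∈S , λ eq → differ (trans (distR-cong r v x) (trans eq (≡.sym (distR-cong r v y))))

resolving? : ∀ {n} (G : Graph n) r S → Dec (Resolving G r S)
resolving? G r S = all? λ x → all? λ y → ¬? (x ≟ y) →-dec
  any? λ v → (v ∈? S) ×-dec ¬? (distR G r v x ℕ.≟ distR G r v y)

thdim? : ∀ {n} (G : Graph n) t → Dec (ThdimLE G t)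
thdim? G t = map′ (λ (r , _ , witness) → r , witness)
  (λ (r , S , resolving , r+∣S∣≤t) → r , s≤s (m+n≤o⇒m≤o r r+∣S∣≤t) , S , resolving , r+∣S∣≤t)
  (anyUpTo? (λ r → anySubset? λ S → resolving? G r S ×-dec (r + ∣ S ∣ ≤? t)) (suc t))

-- Graphs are enumerated through adjacency matrices, i.e. subsets of Fin (n * n); symmetrising
-- every matrix and dropping its diagonal leaves no proof obligations for the search.
fromMatrix : ∀ {n} → Subset (n * n) → Graph n
fromMatrix {n} M = record { adj = edge ; sym = edge-sym ; irrefl = edge-irrefl }
  where
  edge : Fin n → Fin n → Bool
  edge x y = not (isYes (x ≟ y)) ∧ (lookup M (combine x y) ∨ lookup M (combine y x))
  edge-sym : ∀ x y → edge x y ≡ edge y x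
  edge-sym x y = cong₂ (λ b c → not b ∧ c) (isYes-⇔ (mk⇔ ≡.sym ≡.sym) (x ≟ y) (y ≟ x))
                       (∨-comm (lookup M (combine x y)) _)
  edge-irrefl : ∀ x → edge x x ≡ false
  edge-irrefl x with x ≟ x
  ... | yes _   = refl
  ... | no x≢x  = ⊥-elim (x≢x refl)

matrix : ∀ {n} → Graph n → Subset (n * n)
matrix {n} G = tabulate (uncurry (adj G) ∘ remQuot n)

matrix-entry : ∀ {n} (G : Graph n) x y → lookup (matrix G) (combine x y) ≡ adj G x y
matrix-entry G x y = trans (lookup∘tabulate _ (combine x y)) (cong (uncurry (adj G)) (remQuot-combine x y))

fromMatrix-matrix : ∀ {n} (G : Graph n) x y → adj G x y ≡ adj (fromMatrix (matrix G)) x y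
fromMatrix-matrix G x y rewrite matrix-entry G x y | matrix-entry G y x | sym G y x with x ≟ y
... | yes refl = irrefl G x
... | no _     = ≡.sym (∨-idem (adj G x y))

∃thdim? : ∀ n t → Dec (∃[ G ] ThdimLE {n} G t)
∃thdim? n t = map′ (λ (M , th) → fromMatrix M , th)
  (λ (G , th) → matrix G , thdim-cong (fromMatrix-matrix G) th)
  (anySubset? λ M → thdim? (fromMatrix M) t)

isF-least : ∀ {n k} → IsLeast (λ t → ∃[ G ] ThdimLE {n} G t) k → IsF n k
isF-least ((G , thG) , minimal) =
  (G , thG , λ t th → minimal (G , th)) , λ G′ t (th , _) → minimal (G′ , th)

-- Graphs on vectors of landmark distances

module Construction (r : ℕ) where

  R : ℕ
  R = suc r

  Bounded : ∀ {s} → Vec ℕ s → Set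
  Bounded = All (_≤ R)

  Spread : ∀ {s} → Vec ℕ s → Set
  Spread = AllPairs (λ x y → R ≤ x + y)

  Close : ∀ {s} → Vec ℕ s → Vec ℕ s → Set
  Close = Pointwise (λ x y → x ≤ suc y × y ≤ suc x)

  below : ℕ → ℕ
  below x with x <? R
  ... | yes _ = 1
  ... | no  _ = 0

  raise : ℕ → ℕ
  raise x = x + below x

  #below : ∀ {s} → Vec ℕ s → ℕ
  #below = sum ∘ map below

  descend : ∀ {s} → Vec ℕ s → Fin s → Vec ℕ s
  descend (x ∷ xs) zero    = pred x ∷ map raise xs
  descend (x ∷ xs) (suc k) = raise x ∷ descend xs k

  below-< : ∀ {x} → x < R → below x ≡ 1
  below-< {x} x<R with x <? R
  ... | yes _   = refl
  ... | no  x≮R = ⊥-elim (x≮R x<R)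

  below-≥ : ∀ {x} → R ≤ x → below x ≡ 0
  below-≥ {x} R≤x with x <? R
  ... | yes x<R = ⊥-elim (<⇒≱ x<R R≤x)
  ... | no  _   = refl

  below-≤1 : ∀ x → below x ≤ 1
  below-≤1 x with x <? R
  ... | yes _ = ≤-refl
  ... | no  _ = z≤n

  raise-≤R : ∀ {x} → x ≤ R → raise x ≤ R
  raise-≤R {x} x≤R with x <? R
  ... | yes x<R = ≤-trans (≤-reflexive (+-comm x 1)) x<R
  ... | no  _   = ≤-trans (≤-reflexive (+-identityʳ x)) x≤R

  x≤raise[x] : ∀ x → x ≤ raise x
  x≤raise[x] x = m≤m+n x (below x)

  raise[x]≤1+x : ∀ x → raise x ≤ suc x
  raise[x]≤1+x x = ≤-trans (+-monoʳ-≤ x (below-≤1 x)) (≤-reflexive (+-comm x 1))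

  below-raise : ∀ x → below (raise x) ≤ below x
  below-raise x with x <? R
  ... | yes _   = below-≤1 (x + 1)
  ... | no  x≮R = ≤-reflexive (below-≥ (≤-trans (≮⇒≥ x≮R) (m≤m+n x 0)))

  raise-sum : ∀ {x y} → R ≤ x + y → R ≤ raise x + raise y
  raise-sum {x} {y} R≤x+y = ≤-trans R≤x+y (+-mono-≤ (x≤raise[x] x) (x≤raise[x] y))

  pred-raise-sum : ∀ {x y} → R ≤ suc x + y → R ≤ x + raise y
  pred-raise-sum {x} {y} R≤ with y <? R
  ... | yes _   = ≤-trans R≤ (≤-reflexive (trans (≡.sym (+-suc x y)) (cong (x +_) (+-comm 1 y))))
  ... | no  y≮R = ≤-trans (≮⇒≥ y≮R) (≤-trans (m≤m+n y 0) (m≤n+m (y + 0) x))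

  raise-pred-sum : ∀ {x y} → R ≤ x + y → R ≤ raise x + pred y
  raise-pred-sum {x} {y} R≤ with x <? R
  ... | yes _   = ≤-trans R≤ (≤-trans (+-monoʳ-≤ x (n≤1+pred[n] y))
                    (≤-reflexive (trans (+-suc x (pred y)) (cong (_+ pred y) (+-comm 1 x)))))
  ... | no  x≮R = ≤-trans (≮⇒≥ x≮R) (≤-trans (m≤m+n x 0) (m≤m+n (x + 0) (pred y)))

  All-descend : ∀ {P Q : ℕ → Set} {s} {xs : Vec ℕ s} → (∀ {y} → P y → Q (raise y)) →
                (∀ {y} → P y → Q (pred y)) → All P xs → ∀ k → All Q (descend xs k)
  All-descend f g (p ∷ ps) zero    = g p ∷ map⁺ (All.map f ps)
  All-descend f g (p ∷ ps) (suc k) = f p ∷ All-descend f g ps k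

  Bounded-descend : ∀ {s} {b : Vec ℕ s} → Bounded b → ∀ k → Bounded (descend b k)
  Bounded-descend = All-descend raise-≤R (≤-trans pred[n]≤n)

  Spread-raise : ∀ {s} {xs : Vec ℕ s} → Spread xs → Spread (map raise xs)
  Spread-raise []       = []
  Spread-raise {xs = x ∷ _} (p ∷ ps) = map⁺ (All.map (raise-sum {x}) p) ∷ Spread-raise ps

  Spread-descend : ∀ {s} {b : Vec ℕ s} k → 0 < lookup b k → Spread b → Spread (descend b k)
  Spread-descend {b = suc x ∷ xs} zero    _   (p ∷ ps) = map⁺ (All.map (pred-raise-sum {x}) p) ∷ Spread-raise ps
  Spread-descend {b = x ∷ xs}     (suc k) 0<b (p ∷ ps) =
    All-descend (raise-sum {x}) (raise-pred-sum {x}) p k ∷ Spread-descend k 0<b ps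

  Close-raise : ∀ {s} (xs : Vec ℕ s) → Close (map raise xs) xs
  Close-raise []       = []
  Close-raise (x ∷ xs) = (raise[x]≤1+x x , m≤n⇒m≤1+n (x≤raise[x] x)) ∷ Close-raise xs

  Close-descend : ∀ {s} (b : Vec ℕ s) k → Close (descend b k) b
  Close-descend (x ∷ xs) zero    = (≤-trans pred[n]≤n (n≤1+n x) , n≤1+pred[n] x) ∷ Close-raise xs
  Close-descend (x ∷ xs) (suc k) = (raise[x]≤1+x x , m≤n⇒m≤1+n (x≤raise[x] x)) ∷ Close-descend xs k

  lookup-descend : ∀ {s} (b : Vec ℕ s) k → lookup (descend b k) k ≡ pred (lookup b k)
  lookup-descend (x ∷ xs) zero    = refl
  lookup-descend (x ∷ xs) (suc k) = lookup-descend xs k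

  #below-raise : ∀ {s} (xs : Vec ℕ s) → #below (map raise xs) ≤ #below xs
  #below-raise []       = z≤n
  #below-raise (x ∷ xs) = +-mono-≤ (below-raise x) (#below-raise xs)

  #below-descend : ∀ {s} (b : Vec ℕ s) k → lookup b k < R → #below (descend b k) ≤ #below b
  #below-descend (x ∷ xs) zero    x<R  =
    +-mono-≤ (≤-trans (below-≤1 (pred x)) (≤-reflexive (≡.sym (below-< x<R)))) (#below-raise xs)
  #below-descend (x ∷ xs) (suc k) bk<R = +-mono-≤ (below-raise x) (#below-descend xs k bk<R)

  sum-raise : ∀ {s} (xs : Vec ℕ s) → sum (map raise xs) ≡ sum xs + #below xs
  sum-raise []       = refl
  sum-raise (x ∷ xs) = trans (cong (raise x +_) (sum-raise xs)) (interchange x (below x) (sum xs) (#below xs))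

  sum-descend : ∀ {s} (b : Vec ℕ s) k → 0 < lookup b k → lookup b k < R →
                sum (descend b k) + 2 ≡ sum b + #below b
  sum-descend (suc x ∷ xs) zero _ 1+x<R = begin
    x + sum (map raise xs) + 2          ≡⟨ cong (λ t → x + t + 2) (sum-raise xs) ⟩
    x + (sum xs + #below xs) + 2        ≡⟨ solve 3 (λ x t u → x :+ (t :+ u) :+ con 2 := con 1 :+ x :+ t :+ (con 1 :+ u))
                                                   refl x (sum xs) (#below xs) ⟩
    suc x + sum xs + (1 + #below xs)    ≡⟨ cong (λ t → suc x + sum xs + (t + #below xs)) (below-< 1+x<R) ⟨
    suc x + sum xs + #below (suc x ∷ xs) ∎
    where open ≡-Reasoning
          open +-*-Solver
  sum-descend (x ∷ xs) (suc k) 0<bk bk<R = begin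
    raise x + sum (descend xs k) + 2    ≡⟨ +-assoc (raise x) _ 2 ⟩
    raise x + (sum (descend xs k) + 2)  ≡⟨ cong (raise x +_) (sum-descend xs k 0<bk bk<R) ⟩
    raise x + (sum xs + #below xs)      ≡⟨ interchange x (below x) (sum xs) (#below xs) ⟩
    x + sum xs + (below x + #below xs)  ∎
    where open ≡-Reasoning

  sum-descend-grows : ∀ {s} (b : Vec ℕ s) k → 0 < lookup b k → lookup b k < R → 3 ≤ #below b →
                      sum b < sum (descend b k)
  sum-descend-grows b k 0<bk bk<R 3≤#below = +-cancelʳ-≤ 2 _ _ (begin
    suc (sum b) + 2           ≡⟨ +-suc (sum b) 2 ⟨
    sum b + 3                 ≤⟨ +-monoʳ-≤ (sum b) 3≤#below ⟩
    sum b + #below b          ≡⟨ sum-descend b k 0<bk bk<R ⟨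
    sum (descend b k) + 2     ∎)
    where open ≤-Reasoning

  sum-bounded : ∀ {s} {b : Vec ℕ s} → Bounded b → sum b ≤ s * R
  sum-bounded []       = z≤n
  sum-bounded (p ∷ ps) = +-mono-≤ p (sum-bounded ps)

  All-replicate : ∀ {P : ℕ → Set} {x} s → P x → All P (replicate s x)
  All-replicate zero    _  = []
  All-replicate (suc s) px = px ∷ All-replicate s px

  saturated : ∀ {s} {xs : Vec ℕ s} → All (R ≤_) xs → Bounded xs → xs ≡ replicate s R
  saturated []            []            = refl
  saturated (R≤x ∷ R≤xs) (x≤R ∷ xs≤R) = cong₂ _∷_ (≤-antisym x≤R R≤x) (saturated R≤xs xs≤R)

  landmark : ∀ {s} → Fin s → Vec ℕ s
  landmark {suc s} zero    = 0 ∷ replicate s R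
  landmark         (suc i) = R ∷ landmark i

  landmark-bounded : ∀ {s} (i : Fin s) → Bounded (landmark i)
  landmark-bounded {suc s} zero    = z≤n ∷ All-replicate s ≤-refl
  landmark-bounded         (suc i) = ≤-refl ∷ landmark-bounded i

  Spread-replicate : ∀ s → Spread (replicate s R)
  Spread-replicate zero    = []
  Spread-replicate (suc s) = All-replicate s (m≤m+n R R) ∷ Spread-replicate s

  landmark-spread : ∀ {s} (i : Fin s) → Spread (landmark i)
  landmark-spread {suc s} zero    = All-replicate s ≤-refl ∷ Spread-replicate s
  landmark-spread         (suc i) = All.universal (m≤m+n R) _ ∷ landmark-spread i

  lookup-landmark : ∀ {s} (i : Fin s) → lookup (landmark i) i ≡ 0
  lookup-landmark zero    = refl
  lookup-landmark (suc i) = lookup-landmark i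

  #below-replicate : ∀ s → #below (replicate s R) ≡ 0
  #below-replicate zero    = refl
  #below-replicate (suc s) = cong₂ _+_ (below-≥ ≤-refl) (#below-replicate s)

  #below-landmark : ∀ {s} (i : Fin s) → #below (landmark i) ≤ 1
  #below-landmark {suc s} zero    = +-mono-≤ (below-≤1 0) (≤-reflexive (#below-replicate s))
  #below-landmark         (suc i) = ≤-trans (≤-reflexive (cong (_+ #below (landmark i)) (below-≥ ≤-refl))) (#below-landmark i)

  landmark-unique : ∀ {s} {b : Vec ℕ s} i → Bounded b → Spread b → lookup b i ≡ 0 → b ≡ landmark i
  landmark-unique {b = x ∷ xs} zero    (_ ∷ xs≤R) (R≤xs ∷ _) refl = cong (0 ∷_) (saturated R≤xs xs≤R)
  landmark-unique {b = x ∷ xs} (suc i) (x≤R ∷ xs≤R) (R≤x+xs ∷ spread) bi≡0 =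
    cong₂ _∷_ (≤-antisym x≤R R≤x) (landmark-unique i xs≤R spread bi≡0)
    where
    R≤x : R ≤ x
    R≤x = ≤-trans (lookup⁺ R≤x+xs i) (≤-reflexive (trans (cong (x +_) bi≡0) (+-identityʳ x)))

  rank : ∀ {s} → Vec ℕ s → ℕ
  rank {s} b = encode (suc R) b + sum b * suc R ^ s

  rank<[1+sum]* : ∀ {s} {b : Vec ℕ s} → Bounded b → rank b < suc (sum b) * suc R ^ s
  rank<[1+sum]* {b = b} b≤R = +-monoˡ-< (sum b * _) (encode-< (All.map s≤s b≤R))

  rank-injective : ∀ {s} {b c : Vec ℕ s} → Bounded b → Bounded c → rank b ≡ rank c → b ≡ c
  rank-injective {b = b} {c} b≤R c≤R eq = encode-injective (All.map s≤s b≤R) (All.map s≤s c≤R)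
    (proj₁ (digits-unique (sum b) (sum c) (encode-< (All.map s≤s b≤R)) (encode-< (All.map s≤s c≤R)) eq))

  rank-mono-sum : ∀ {s} {b c : Vec ℕ s} → Bounded b → sum b < sum c → rank b < rank c
  rank-mono-sum {s} {b} {c} b≤R sum-b<sum-c = begin-strict
    rank b                     <⟨ rank<[1+sum]* b≤R ⟩
    suc (sum b) * suc R ^ s    ≤⟨ *-monoˡ-≤ (suc R ^ s) sum-b<sum-c ⟩
    sum c * suc R ^ s          ≤⟨ m≤n+m _ (encode (suc R) c) ⟩
    rank c                     ∎
    where open ≤-Reasoning

  rank-< : ∀ {s} {b : Vec ℕ s} → Bounded b → rank b < suc (s * R) * suc R ^ s
  rank-< b≤R = <-≤-trans (rank<[1+sum]* b≤R) (*-monoˡ-≤ _ (s≤s (sum-bounded b≤R)))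

  box : ∀ s → List (Vec ℕ s)
  box zero    = [] ∷ []
  box (suc s) = cartesianProductWith _∷_ (downFrom (suc R)) (box s)

  box-complete : ∀ {s} {b : Vec ℕ s} → Bounded b → b ∈ box s
  box-complete []           = here refl
  box-complete (x≤R ∷ xs≤R) = ∈-cartesianProductWith⁺ _∷_ (∈-downFrom⁺ (s≤s x≤R)) (box-complete xs≤R)

  box-bounded : ∀ {s} {b : Vec ℕ s} → b ∈ box s → Bounded b
  box-bounded {zero}  {[]} _   = []
  box-bounded {suc s}      b∈ with _ , _ , x∈ , xs∈ , refl ← ∈-cartesianProductWith⁻ _∷_ (downFrom (suc R)) (box s) b∈ =
    ≤-pred (∈-downFrom⁻ x∈) ∷ box-bounded xs∈

  box-unique : ∀ s → Unique (box s)
  box-unique zero    = ListAll.[] ∷ []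
  box-unique (suc s) = Unique.cartesianProductWith⁺ _∷_ (λ { refl → refl , refl }) (Unique.downFrom⁺ (suc R)) (box-unique s)

  record ClosedFamily (s : ℕ) : Set where
    field
      members   : List (Vec ℕ s)
      unique    : Unique members
      valid     : ∀ {b} → b ∈ members → Bounded b × Spread b
      landmarks : ∀ i → landmark i ∈ members
      closed    : ∀ {b} → b ∈ members → ∀ k → 0 < lookup b k → lookup b k ≤ r → descend b k ∈ members

  module FamilyGraph {s} (F : ClosedFamily s) where
    open ClosedFamily F

    vertex : Fin (length members) → Vec ℕ s
    vertex = List.lookup members

    vertex-index : ∀ {b} (b∈ : b ∈ members) → vertex (index b∈) ≡ b
    vertex-index b∈ = ≡.sym (lookup-index b∈)

    Edge : Fin (length members) → Fin (length members) → Set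
    Edge x y = x ≢ y × Close (vertex x) (vertex y)

    edge? : ∀ x y → Dec (Edge x y)
    edge? x y = ¬? (x ≟ y) ×-dec Pointwise.decidable (λ u w → (u ≤? suc w) ×-dec (w ≤? suc u)) (vertex x) (vertex y)

    Edge-sym : ∀ {x y} → Edge x y → Edge y x
    Edge-sym (x≢y , close) = x≢y ∘ ≡.sym , Pointwise.sym swap close

    graph : Graph (length members)
    graph = record
      { adj    = λ x y → isYes (edge? x y)
      ; sym    = λ x y → isYes-⇔ (mk⇔ Edge-sym Edge-sym) (edge? x y) (edge? y x)
      ; irrefl = λ x → isYes-false (λ (x≢x , _) → x≢x refl) (edge? x x)
      }

    landmarkVertex : Fin s → Fin (length members)
    landmarkVertex i = index (landmarks i)

    coordinate-layering : ∀ i → Layering graph r (landmarkVertex i) (λ y → lookup (vertex y) i)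
    coordinate-layering i = record
      { root      = trans (cong (λ b → lookup b i) (vertex-index (landmarks i))) (lookup-landmark i)
      ; root-only = root-only
      ; lipschitz = λ edge → proj₂ (Pointwise.lookup (proj₂ (toWitness edge)) i)
      ; descent   = descent
      }
      where
      root-only : ∀ {y} → lookup (vertex y) i ≡ 0 → y ≡ landmarkVertex i
      root-only {y} yi≡0 =
        let b≤R , spread = valid (∈-lookup y)
        in lookup-injective unique (trans (landmark-unique i b≤R spread yi≡0) (≡.sym (vertex-index (landmarks i))))
      descent : ∀ {y} → 0 < lookup (vertex y) i → lookup (vertex y) i ≤ r →
                ∃[ z ] (T (isYes (edge? z y)) × suc (lookup (vertex z) i) ≡ lookup (vertex y) i)
      descent {y} 0<yi yi≤r = z , fromWitness (z≢y , close) , 1+zi≡yi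
        where
        instance
          yi≢0 : NonZero (lookup (vertex y) i)
          yi≢0 = >-nonZero 0<yi
        z∈ = closed (∈-lookup y) i 0<yi yi≤r
        z = index z∈
        1+zi≡yi : suc (lookup (vertex z) i) ≡ lookup (vertex y) i
        1+zi≡yi = trans (cong (λ b → suc (lookup b i)) (vertex-index z∈))
                        (trans (cong suc (lookup-descend (vertex y) i)) (suc-pred _))
        z≢y : z ≢ y
        z≢y z≡y = 1+n≢n (trans (cong (λ w → suc (lookup (vertex w) i)) (≡.sym z≡y)) 1+zi≡yi)
        close : Close (vertex z) (vertex y)
        close = subst (λ b → Close b (vertex y)) (≡.sym (vertex-index z∈)) (Close-descend (vertex y) i)

    distR-landmark : ∀ i y → distR graph r (landmarkVertex i) y ≡ lookup (vertex y) i
    distR-landmark i y = distR-layering (coordinate-layering i) (lookup⁺ (proj₁ (valid (∈-lookup y))) i)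

    landmarks-resolve : Resolving graph r (image landmarkVertex)
    landmarks-resolve x y x≢y =
      let i , differ = ¬∀⟶∃¬ s _ (λ i → lookup (vertex x) i ℕ.≟ lookup (vertex y) i)
                         (λ same → x≢y (lookup-injective unique (≗-lookup⇒≡ same)))
      in landmarkVertex i , ∈-image landmarkVertex i ,
         λ eq → differ (trans (≡.sym (distR-landmark i x)) (trans eq (distR-landmark i y)))

    graph-thdim : ThdimLE graph (r + s)
    graph-thdim = r , image landmarkVertex , landmarks-resolve , +-monoʳ-≤ r (∣image∣≤ landmarkVertex)

  Member : ℕ → ∀ {s} → Vec ℕ s → Set
  Member θ b = Spread b × (#below b ≤ 2 ⊎ θ ≤ rank b)

  member? : ∀ θ {s} → Decidable (Member θ {s})
  member? θ b = allPairs? (λ x y → R ≤? x + y) b ×-dec (#below b ≤? 2 ⊎-dec θ ≤? rank b)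

  module _ {s : ℕ} (θ : ℕ) where

    family : List (Vec ℕ s)
    family = filter (member? θ) (box s)

    family-closed : ∀ {b} → b ∈ family → ∀ k → 0 < lookup b k → lookup b k ≤ r → descend b k ∈ family
    family-closed {b} b∈ k 0<bk bk≤r with b∈box , spread , few-or-late ← ∈-filter⁻ (member? θ) b∈ =
      ∈-filter⁺ (member? θ) (box-complete (Bounded-descend b≤R k)) (Spread-descend k 0<bk spread , still few-or-late)
      where
      b≤R = box-bounded b∈box
      bk<R = s≤s bk≤r
      still : #below b ≤ 2 ⊎ θ ≤ rank b → #below (descend b k) ≤ 2 ⊎ θ ≤ rank (descend b k)
      still (inj₁ few) = inj₁ (≤-trans (#below-descend b k bk<R) few)
      still (inj₂ late) with #below (descend b k) ≤? 2
      ... | yes few = inj₁ few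
      ... | no  many = inj₂ (≤-trans late (<⇒≤ (rank-mono-sum {c = descend b k} b≤R
                         (sum-descend-grows b k 0<bk bk<R (≤-trans (≰⇒> many) (#below-descend b k bk<R))))))

    closedFamily : ClosedFamily s
    closedFamily = record
      { members   = family
      ; unique    = Unique.filter⁺ (member? θ) (box-unique s)
      ; valid     = λ b∈ → let b∈box , spread , _ = ∈-filter⁻ (member? θ) b∈ in box-bounded b∈box , spread
      ; landmarks = λ i → ∈-filter⁺ (member? θ) (box-complete (landmark-bounded i))
                            (landmark-spread i , inj₁ (≤-trans (#below-landmark i) (s≤s z≤n)))
      ; closed    = family-closed
      }

  size : ∀ s → ℕ → ℕ
  size s θ = length (family {s} θ)

  size-≤-suc : ∀ s θ → size s θ ≤ suc (size s (suc θ))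
  size-≤-suc s θ = begin
    size s θ
      ≤⟨ count-mono (member? θ) member-or-at (box s) (λ _ → split) ⟩
    count member-or-at (box s)
      ≤⟨ count-⊎ (member? (suc θ)) (λ b → rank b ℕ.≟ θ) (box s) ⟩
    size s (suc θ) + count (λ b → rank b ℕ.≟ θ) (box s)
      ≤⟨ +-monoʳ-≤ (size s (suc θ)) at-most-one ⟩
    size s (suc θ) + 1
      ≡⟨ +-comm (size s (suc θ)) 1 ⟩
    suc (size s (suc θ))
      ∎
    where
    open ≤-Reasoning
    member-or-at : Decidable (λ (b : Vec ℕ s) → Member (suc θ) b ⊎ rank b ≡ θ)
    member-or-at b = member? (suc θ) b ⊎-dec rank b ℕ.≟ θ
    split : ∀ {b : Vec ℕ s} → Member θ b → Member (suc θ) b ⊎ rank b ≡ θ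
    split (spread , inj₁ few) = inj₁ (spread , inj₁ few)
    split (spread , inj₂ θ≤rank) with m≤n⇒m<n∨m≡n θ≤rank
    ... | inj₁ θ<rank = inj₁ (spread , inj₂ θ<rank)
    ... | inj₂ θ≡rank = inj₂ (≡.sym θ≡rank)
    at-most-one : count (λ b → rank b ℕ.≟ θ) (box s) ≤ 1
    at-most-one = count-≤1 (λ b → rank b ℕ.≟ θ) (box-unique s) λ b∈ c∈ rb≡θ rc≡θ →
      rank-injective (box-bounded b∈) (box-bounded c∈) (trans rb≡θ (≡.sym rc≡θ))

  few : ∀ s → ℕ → ℕ
  few s t = count (λ b → #below b ≤? t) (box s)

  θ-top : ℕ → ℕ
  θ-top s = suc (s * R) * suc R ^ s

  size-top : ∀ s → size s (θ-top s) ≤ few s 2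
  size-top s = count-mono (member? (θ-top s)) (λ b → #below b ≤? 2) (box s) not-late
    where
    not-late : ∀ {b} → b ∈ box s → Member (θ-top s) b → #below b ≤ 2
    not-late _  (_ , inj₁ few≤2) = few≤2
    not-late b∈ (_ , inj₂ late)  = ⊥-elim (<⇒≱ (rank-< (box-bounded b∈)) late)

  count-few : ∀ s t → few s t ≤ suc (s * R) ^ t
  count-few zero    t = ≤-reflexive (≡.sym (^-zeroˡ t))
  count-few (suc s) t = begin
    few (suc s) t
      ≡⟨ count-cartesianProductWith _ _∷_ (downFrom (suc R)) (box s) ⟩
    with-head R + sumˡ (List.map with-head (downFrom R))
      ≤⟨ +-mono-≤ saturated-head (sum-downFrom-≤ with-head R (unsaturated-head t)) ⟩
    few s t + R * few′ t
      ≤⟨ bound t ⟩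
    suc (suc s * R) ^ t
      ∎
    where
    open ≤-Reasoning
    with-head : ℕ → ℕ
    with-head x = count (λ v → #below (x ∷ v) ≤? t) (box s)
    few′ : ℕ → ℕ
    few′ zero    = 0
    few′ (suc t) = few s t
    saturated-head : with-head R ≤ few s t
    saturated-head = count-mono (λ v → #below (R ∷ v) ≤? t) (λ v → #below v ≤? t) (box s)
      (λ {v} _ ≤t → ≤-trans (m≤n+m (#below v) (below R)) ≤t)
    unsaturated-head : ∀ t {x} → x < R → count (λ v → #below (x ∷ v) ≤? t) (box s) ≤ few′ t
    unsaturated-head zero     {x} x<R = ≤-reflexive (cong length (filter-none (λ v → #below (x ∷ v) ≤? 0) {box s}
      (ListAll.tabulate λ {v} _ ≤0 →
        1+n≰n (≤-trans (≤-reflexive (≡.sym (below-< x<R))) (≤-trans (m≤m+n (below x) (#below v)) ≤0)))))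
    unsaturated-head (suc t′) {x} x<R = count-mono (λ v → #below (x ∷ v) ≤? suc t′) (λ v → #below v ≤? t′) (box s)
      (λ {v} _ ≤1+t′ → ≤-pred (≤-trans (≤-reflexive (cong (_+ #below v) (≡.sym (below-< x<R)))) ≤1+t′))
    bound : ∀ t → few s t + R * few′ t ≤ suc (suc s * R) ^ t
    bound zero     = ≤-trans (≤-reflexive (trans (cong (few s 0 +_) (*-zeroʳ R)) (+-identityʳ _))) (count-few s 0)
    bound (suc t′) = begin
      few s (suc t′) + R * few s t′
        ≤⟨ +-mono-≤ (count-few s (suc t′)) (*-monoʳ-≤ R (count-few s t′)) ⟩
      suc (s * R) * X + R * X
        ≡⟨ *-distribʳ-+ X (suc (s * R)) R ⟨
      (suc (s * R) + R) * X
        ≡⟨ cong (λ m → suc m * X) (+-comm (s * R) R) ⟩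
      suc (suc s * R) * X
        ≤⟨ *-monoʳ-≤ (suc (suc s * R)) (^-monoˡ-≤ t′ (s≤s (m≤n+m (s * R) R))) ⟩
      suc (suc s * R) * suc (suc s * R) ^ t′
        ∎
      where X = suc (s * R) ^ t′

  Spread-above : ∀ {a s} {b : Vec ℕ s} → R ≤ a + a → All (a ≤_) b → Spread b
  Spread-above R≤2a []           = []
  Spread-above R≤2a (a≤x ∷ a≤xs) =
    All.map (λ a≤y → ≤-trans R≤2a (+-mono-≤ a≤x a≤y)) a≤xs ∷ Spread-above R≤2a a≤xs

  count-above : ∀ a s → (suc R ∸ a) ^ s ≤ count (All.all? (a ≤?_)) (box s)
  count-above a zero    = ≤-refl
  count-above a (suc s) = begin
    (suc R ∸ a) * (suc R ∸ a) ^ s              ≤⟨ *-monoʳ-≤ (suc R ∸ a) (count-above a s) ⟩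
    (suc R ∸ a) * above                        ≤⟨ sum-downFrom-≥ with-head (suc R) (λ {x} a≤x _ →
                                                    count-mono (All.all? (a ≤?_)) (λ v → All.all? (a ≤?_) (x ∷ v)) (box s)
                                                      (λ _ a≤xs → a≤x ∷ a≤xs)) ⟩
    sumˡ (List.map with-head (downFrom (suc R))) ≡⟨ count-cartesianProductWith _ _∷_ (downFrom (suc R)) (box s) ⟨
    count (All.all? (a ≤?_)) (box (suc s))     ∎
    where
    open ≤-Reasoning
    above = count (All.all? (a ≤?_)) (box s)
    with-head : ℕ → ℕ
    with-head x = count (λ v → All.all? (a ≤?_) (x ∷ v)) (box s)

  size-bottom : ∀ s a → R ≤ a + a → (suc R ∸ a) ^ s ≤ size s 0
  size-bottom s a R≤2a = ≤-trans (count-above a s)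
    (count-mono (All.all? (a ≤?_)) (member? 0) (box s) λ _ a≤b → Spread-above R≤2a a≤b , inj₂ z≤n)

  graph-of-order : ∀ s a {n} → R ≤ a + a → few s 2 ≤ n → n ≤ (suc R ∸ a) ^ s → ∃[ G ] ThdimLE {n} G (r + s)
  graph-of-order s a R≤2a few≤n n≤above =
    let θ , size≡n = discrete-ivt (size s) (size-≤-suc s) (θ-top s)
                       (≤-trans (size-top s) few≤n) (≤-trans n≤above (size-bottom s a R≤2a))
        open FamilyGraph (closedFamily θ)
    in subst (λ m → ∃[ G ] ThdimLE {m} G (r + s)) size≡n (graph , graph-thdim)

-- Logarithmic estimates

⌊log₂⌋≤ : ∀ {n} X → n ≤ 2 ^ X → ⌊log₂ n ⌋ ≤ X
⌊log₂⌋≤ X n≤2^X = ≤-trans (⌊log₂⌋-mono-≤ n≤2^X) (≤-reflexive (⌊log₂[2^n]⌋≡n X))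

≤⌊log₂⌋ : ∀ {n} X → 2 ^ X ≤ n → X ≤ ⌊log₂ n ⌋
≤⌊log₂⌋ X 2^X≤n = ≤-trans (≤-reflexive (≡.sym (⌊log₂[2^n]⌋≡n X))) (⌊log₂⌋-mono-≤ 2^X≤n)

2^⌊log₂n⌋≤n : ∀ n → 0 < n → 2 ^ ⌊log₂ n ⌋ ≤ n
2^⌊log₂n⌋≤n = <-rec (λ n → 0 < n → 2 ^ ⌊log₂ n ⌋ ≤ n) bound
  where
  bound : ∀ n → (∀ {m} → m < n → 0 < m → 2 ^ ⌊log₂ m ⌋ ≤ m) → 0 < n → 2 ^ ⌊log₂ n ⌋ ≤ n
  bound (suc zero)    _       _ = ≤-refl
  bound (suc (suc m)) smaller _ = begin
    2 ^ ⌊log₂ n ⌋        ≡⟨ cong (2 ^_) ⌊log₂n⌋≡1+⌊log₂h⌋ ⟩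
    2 * 2 ^ ⌊log₂ h ⌋    ≤⟨ *-monoʳ-≤ 2 (smaller (⌊n/2⌋<n (suc m)) (s≤s z≤n)) ⟩
    h + (h + 0)          ≤⟨ +-monoʳ-≤ h (≤-trans (≤-reflexive (+-identityʳ h)) (⌊n/2⌋≤⌈n/2⌉ n)) ⟩
    h + ⌈ n /2⌉          ≡⟨ ⌊n/2⌋+⌈n/2⌉≡n n ⟩
    n                    ∎
    where
    open ≤-Reasoning
    n = suc (suc m)
    h = ⌊ n /2⌋
    ⌊log₂n⌋≡1+⌊log₂h⌋ : ⌊log₂ n ⌋ ≡ suc ⌊log₂ h ⌋
    ⌊log₂n⌋≡1+⌊log₂h⌋ = trans (≡.sym (m+[n∸m]≡n (≤⌊log₂⌋ {n} 1 (s≤s (s≤s z≤n)))))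
                              (cong suc (≡.sym (⌊log₂⌊n/2⌋⌋≡⌊log₂n⌋∸1 n)))

⌊log₂⌋< : ∀ {n} X → 0 < n → n < 2 ^ X → ⌊log₂ n ⌋ < X
⌊log₂⌋< {n} X 0<n n<2^X = ≰⇒> λ X≤⌊log₂n⌋ →
  <⇒≱ n<2^X (≤-trans (^-monoʳ-≤ 2 X≤⌊log₂n⌋) (2^⌊log₂n⌋≤n n 0<n))

n<2^[1+⌊log₂n⌋] : ∀ n → n < 2 ^ suc ⌊log₂ n ⌋
n<2^[1+⌊log₂n⌋] n = ≰⇒> λ 2^[1+⌊log₂n⌋]≤n → 1+n≰n (≤⌊log₂⌋ (suc ⌊log₂ n ⌋) 2^[1+⌊log₂n⌋]≤n)

1+n≤2^n : ∀ n → suc n ≤ 2 ^ n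
1+n≤2^n zero    = ≤-refl
1+n≤2^n (suc n) =
  +-mono-≤ (≤-trans (s≤s z≤n) (1+n≤2^n n)) (≤-trans (1+n≤2^n n) (≤-reflexive (≡.sym (+-identityʳ _))))

^-≤-2^ : ∀ {a b} c → a ≤ 2 ^ b → a ^ c ≤ 2 ^ (b * c)
^-≤-2^ {b = b} c a≤2^b = ≤-trans (^-monoˡ-≤ c a≤2^b) (≤-reflexive (^-*-assoc 2 b c))

n≤[1+n]^n : ∀ n → n ≤ suc n ^ n
n≤[1+n]^n zero    = z≤n
n≤[1+n]^n (suc n) = ≤-trans (<⇒≤ (1+n≤2^n (suc n))) (^-monoˡ-≤ (suc n) (s≤s (s≤s z≤n)))

cube-bound : ∀ s → 4 ≤ s → suc (s * suc (2 * s)) ≤ s * s * s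
cube-bound s 4≤s with u , refl ← m≤n⇒∃[o]m+o≡n 4≤s =
  ≤-trans (m≤m+n _ (27 + 31 * u + 10 * (u * u) + u * u * u)) (≤-reflexive (solve 1 (λ u →
      (con 1 :+ (con 4 :+ u) :* (con 1 :+ con 2 :* (con 4 :+ u)))
        :+ (con 27 :+ con 31 :* u :+ con 10 :* (u :* u) :+ u :* u :* u)
      := (con 4 :+ u) :* (con 4 :+ u) :* (con 4 :+ u)) refl u))
  where open +-*-Solver

few-bound : ∀ s → 17 ≤ s → suc (s * suc (2 * s)) ^ 2 ≤ s ^ pred s
few-bound s 17≤s = begin
  suc (s * suc (2 * s)) ^ 2  ≤⟨ ^-monoˡ-≤ 2 (cube-bound s (≤-trans (m≤m+n 4 13) 17≤s)) ⟩
  (s * s * s) ^ 2            ≡⟨ solve 1 (λ s → (s :* s :* s) :^ 2 := s :^ 6) refl s ⟩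
  s ^ 6                      ≤⟨ ^-monoʳ-≤ s (≤-trans (m≤m+n 6 10) (pred-mono-≤ 17≤s)) ⟩
  s ^ pred s                 ∎
  where
  open ≤-Reasoning
  open +-*-Solver
  instance
    s≢0 : NonZero s
    s≢0 = >-nonZero (≤-trans (s≤s z≤n) 17≤s)

module Sandwich {s′ n : ℕ} (16≤s′ : 16 ≤ s′) (n>s^s′ : suc s′ ^ s′ < n)
                (n≤[1+s]^s : n ≤ suc (suc s′) ^ suc s′) where

  open +-*-Solver
  open ≤-Reasoning

  s σ ℓ ℓℓ : ℕ
  s  = suc s′
  σ  = ⌊log₂ s ⌋
  ℓ  = ⌊log₂ n ⌋
  ℓℓ = ⌊log₂ ℓ ⌋

  1≤s′ : 1 ≤ s′
  1≤s′ = ≤-trans (s≤s z≤n) 16≤s′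

  4≤σ : 4 ≤ σ
  4≤σ = ≤⌊log₂⌋ 4 (≤-trans 16≤s′ (n≤1+n s′))

  2^σ≤s : 2 ^ σ ≤ s
  2^σ≤s = 2^⌊log₂n⌋≤n s (s≤s z≤n)

  s<2^[1+σ] : s < 2 ^ suc σ
  s<2^[1+σ] = n<2^[1+⌊log₂n⌋] s

  ℓ≤[1+σ]*s : ℓ ≤ suc σ * s
  ℓ≤[1+σ]*s = ⌊log₂⌋≤ (suc σ * s) (≤-trans n≤[1+s]^s (^-≤-2^ {b = suc σ} s s<2^[1+σ]))

  σ*s′≤ℓ : σ * s′ ≤ ℓ
  σ*s′≤ℓ = ≤⌊log₂⌋ (σ * s′) (begin
    2 ^ (σ * s′)   ≡⟨ ^-*-assoc 2 σ s′ ⟨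
    (2 ^ σ) ^ s′   ≤⟨ ^-monoˡ-≤ s′ 2^σ≤s ⟩
    s ^ s′         <⟨ n>s^s′ ⟩
    n              ∎)

  s≤ℓ : s ≤ ℓ
  s≤ℓ = begin
    suc s′          ≤⟨ s≤s (≤-reflexive (≡.sym (+-identityʳ s′))) ⟩
    1 + (s′ + 0)    ≤⟨ +-monoˡ-≤ (s′ + 0) 1≤s′ ⟩
    2 * s′          ≤⟨ *-monoˡ-≤ s′ (≤-trans (s≤s (s≤s z≤n)) 4≤σ) ⟩
    σ * s′          ≤⟨ σ*s′≤ℓ ⟩
    ℓ               ∎

  σ≤ℓℓ : σ ≤ ℓℓ
  σ≤ℓℓ = ≤⌊log₂⌋ σ (≤-trans 2^σ≤s s≤ℓ)

  ℓℓ≤σ+σ : ℓℓ ≤ σ + σ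
  ℓℓ≤σ+σ = ≤-pred (≤-trans (⌊log₂⌋< (σ + suc σ) (≤-trans (s≤s z≤n) s≤ℓ) ℓ<2^[σ+1+σ])
                            (≤-reflexive (+-suc σ σ)))
    where
    ℓ<2^[σ+1+σ] : ℓ < 2 ^ (σ + suc σ)
    ℓ<2^[σ+1+σ] = begin-strict
      ℓ                    ≤⟨ ℓ≤[1+σ]*s ⟩
      suc σ * s            ≤⟨ *-monoˡ-≤ s (1+n≤2^n σ) ⟩
      2 ^ σ * s            <⟨ *-monoʳ-< (2 ^ σ) {{m^n≢0 2 σ}} s<2^[1+σ] ⟩
      2 ^ σ * 2 ^ suc σ    ≡⟨ ^-distribˡ-+-* 2 σ (suc σ) ⟨
      2 ^ (σ + suc σ)      ∎

  k*ℓℓ≤12*ℓ : ∀ {k} → k ≤ 3 * s → k * ℓℓ ≤ 12 * ℓ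
  k*ℓℓ≤12*ℓ {k} k≤3s = begin
    k * ℓℓ                ≤⟨ *-mono-≤ k≤3s ℓℓ≤σ+σ ⟩
    3 * s * (σ + σ)       ≤⟨ m≤m+n _ (6 * σ * pred s′) ⟩
    3 * s * (σ + σ) + 6 * σ * pred s′  ≡⟨ cancel-s′ s′ 1≤s′ ⟩
    12 * (σ * s′)         ≤⟨ *-monoʳ-≤ 12 σ*s′≤ℓ ⟩
    12 * ℓ                ∎
    where
    cancel-s′ : ∀ t → 1 ≤ t → 3 * suc t * (σ + σ) + 6 * σ * pred t ≡ 12 * (σ * t)
    cancel-s′ (suc u) _ = solve 2 (λ u σ →
      con 3 :* (con 2 :+ u) :* (σ :+ σ) :+ con 6 :* σ :* u := con 12 :* (σ :* (con 1 :+ u))) refl u σ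

  ℓ≤3*k*ℓℓ : ∀ {k} → k ≤ 3 * s → n ≤ (2 + k) ^ k → ℓ ≤ 3 * (k * ℓℓ)
  ℓ≤3*k*ℓℓ {k} k≤3s n≤[2+k]^k = begin
    ℓ              ≤⟨ ℓ≤[1+κ]*k ⟩
    suc κ * k      ≤⟨ *-monoˡ-≤ k (≤-trans 1+κ≤σ+3 σ+3≤3*σ) ⟩
    3 * σ * k      ≡⟨ solve 2 (λ σ k → con 3 :* σ :* k := con 3 :* (k :* σ)) refl σ k ⟩
    3 * (k * σ)    ≤⟨ *-monoʳ-≤ 3 (*-monoʳ-≤ k σ≤ℓℓ) ⟩
    3 * (k * ℓℓ)   ∎
    where
    κ = ⌊log₂ (2 + k) ⌋
    ℓ≤[1+κ]*k : ℓ ≤ suc κ * k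
    ℓ≤[1+κ]*k = ⌊log₂⌋≤ {n} (suc κ * k)
      (≤-trans n≤[2+k]^k (^-≤-2^ {b = suc κ} k (<⇒≤ (n<2^[1+⌊log₂n⌋] (2 + k)))))
    σ+3≤3*σ : σ + 3 ≤ 3 * σ
    σ+3≤3*σ = +-monoʳ-≤ σ (≤-trans (≤-trans (m≤m+n 3 1) 4≤σ) (m≤m+n σ (σ + 0)))
    2+k<2^[σ+3] : 2 + k < 2 ^ (σ + 3)
    2+k<2^[σ+3] = begin-strict
      2 + k            ≤⟨ s≤s (s≤s k≤3s) ⟩
      2 + 3 * s        ≤⟨ +-monoˡ-≤ (3 * s) (s≤s 1≤s′) ⟩
      s + 3 * s        ≡⟨ solve 1 (λ s → s :+ con 3 :* s := con 4 :* s) refl s ⟩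
      4 * s            <⟨ *-monoʳ-< 4 s<2^[1+σ] ⟩
      4 * 2 ^ suc σ    ≡⟨ solve 1 (λ x → con 4 :* (con 2 :* x) := con 2 :* (con 2 :* (con 2 :* x))) refl (2 ^ σ) ⟩
      2 ^ (3 + σ)      ≡⟨ cong (2 ^_) (+-comm 3 σ) ⟩
      2 ^ (σ + 3)      ∎
    1+κ≤σ+3 : suc κ ≤ σ + 3
    1+κ≤σ+3 = ⌊log₂⌋< {2 + k} (σ + 3) (s≤s z≤n) 2+k<2^[σ+3]

-- Large enough that the least s with n ≤ (s+1)^s is at least 17, which few-bound and Sandwich need.
n₀ : ℕ
n₀ = suc (17 ^ 16)

scale : ∀ {n} → n₀ ≤ n → ∃[ s′ ] (16 ≤ s′ × suc s′ ^ s′ < n × n ≤ suc (suc s′) ^ suc s′)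
scale {n} n₀≤n with least (λ s → n ≤? suc s ^ s) {n} (n≤[1+n]^n n)
... | s , n≤[1+s]^s , minimal with 17 ≤? s
...   | yes (s≤s 16≤s′) = _ , 16≤s′ , ≰⇒> (λ n≤s^s′ → 1+n≰n (minimal n≤s^s′)) , n≤[1+s]^s
...   | no  17≰s        = ⊥-elim (<⇒≱ n₀≤n (begin
  n              ≤⟨ n≤[1+s]^s ⟩
  suc s ^ s      ≤⟨ ^-monoˡ-≤ s (s≤s s≤16) ⟩
  17 ^ s         ≤⟨ ^-monoʳ-≤ 17 s≤16 ⟩
  17 ^ 16        ∎))
  where
  open ≤-Reasoning
  s≤16 : s ≤ 16
  s≤16 = ≤-pred (≰⇒> 17≰s)

graph-at-scale : ∀ {s′ n} → 16 ≤ s′ → suc s′ ^ s′ < n → n ≤ suc (suc s′) ^ suc s′ →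
                 ∃[ G ] ThdimLE {n} G (3 * suc s′)
graph-at-scale {s′} {n} 16≤s′ n>s^s′ n≤[1+s]^s =
  subst (λ t → ∃[ G ] ThdimLE {n} G t) (+-comm (2 * s) s) (graph-of-order s (suc s) R≤2+2s few≤n n≤[R+1-s-1]^s)
  where
  s = suc s′
  open Construction (2 * s)
  R≤2+2s : R ≤ suc s + suc s
  R≤2+2s = s≤s (≤-trans (+-monoʳ-≤ s (≤-trans (≤-reflexive (+-identityʳ s)) (n≤1+n s))) ≤-refl)
  few≤n : few s 2 ≤ n
  few≤n = ≤-trans (count-few s 2) (≤-trans (few-bound s (s≤s 16≤s′)) (<⇒≤ n>s^s′))
  n≤[R+1-s-1]^s : n ≤ (suc R ∸ suc s) ^ s
  n≤[R+1-s-1]^s = ≤-trans n≤[1+s]^s (≤-reflexive (cong (_^ s) (≡.sym (begin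
    suc (s + (s + 0)) ∸ s   ≡⟨ cong (_∸ s) (+-suc s (s + 0)) ⟨
    s + suc (s + 0) ∸ s     ≡⟨ m+n∸m≡n s (suc (s + 0)) ⟩
    suc (s + 0)             ≡⟨ cong suc (+-identityʳ s) ⟩
    suc s                   ∎))))
    where open ≡-Reasoning

f-attained : ∀ n {t} → ∃[ G ] ThdimLE {n} G t → ∃[ k ] (IsF n k × k ≤ t × n ≤ (2 + k) ^ k)
f-attained n witness =
  let k , (G , thG) , minimal = least (∃thdim? n) witness
  in k , isF-least ((G , thG) , minimal) , minimal witness , thdim⇒order≤ G thG

mainTheorem4 :
    ∃[ p1 ] ∃[ q1 ] ∃[ p2 ] ∃[ q2 ] ∃[ n0 ]
      (0 < p1 × 0 < q1 × 0 < p2 × 0 < q2 ×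
       (∀ n → n0 ≤ n → ∃[ k ] (IsF n k ×
          p1 * ⌊log₂ n ⌋ ≤ q1 * (k * ⌊log₂ ⌊log₂ n ⌋ ⌋) ×
          q2 * (k * ⌊log₂ ⌊log₂ n ⌋ ⌋) ≤ p2 * ⌊log₂ n ⌋)))
mainTheorem4 = 1 , 3 , 12 , 1 , n₀ , s≤s z≤n , s≤s z≤n , s≤s z≤n , s≤s z≤n , bounds
  where
  bounds : ∀ n → n₀ ≤ n → ∃[ k ] (IsF n k ×
             1 * ⌊log₂ n ⌋ ≤ 3 * (k * ⌊log₂ ⌊log₂ n ⌋ ⌋) ×
             1 * (k * ⌊log₂ ⌊log₂ n ⌋ ⌋) ≤ 12 * ⌊log₂ n ⌋)
  bounds n n₀≤n =
    let s′ , 16≤s′ , n>s^s′ , n≤[1+s]^s = scale n₀≤n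
        k , isF , k≤3s , n≤[2+k]^k = f-attained n (graph-at-scale 16≤s′ n>s^s′ n≤[1+s]^s)
    in k , isF ,
       ≤-trans (≤-reflexive (*-identityˡ _)) (Sandwich.ℓ≤3*k*ℓℓ 16≤s′ n>s^s′ n≤[1+s]^s k≤3s n≤[2+k]^k) ,
       ≤-trans (≤-reflexive (*-identityˡ _)) (Sandwich.k*ℓℓ≤12*ℓ 16≤s′ n>s^s′ n≤[1+s]^s k≤3s)
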